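{- Let $m,n,l\ge 1$ and let $\eta_1=([a_1,b_1],\dots,[a_m,b_m])$, $\eta_2=([c_1,d_1],\dots,[c_n,d_n])$ and $\eta_3=([g_1,h_1],\dots,[g_l,h_l])$ be three sequences of intervals with nonnegative integer endpoints, such that $a_1\ge\cdots\ge a_m$, $c_1\ge\cdots\ge c_n$ and $g_1\ge\cdots\ge g_l$. Suppose there is a simple tripartite graph $G$ with vertex classes $X=\{x_1,\dots,x_m\}$, $Y=\{y_1,\dots,y_n\}$, $Z=\{z_1,\dots,z_l\}$ such that $a_i\le d_G(x_i)\le b_i$, $c_j\le d_G(y_j)\le d_j$, $g_k\le d_G(z_k)\le h_k$ for all $i,j,k$. Then \begin{itemize} \item $\sum_{i=1}^{\tau}a_i\le\sum_{j=1}^{n}\min\{d_j,\tau\}+\sum_{j=1}^{l}\min\{h_j,\tau\}$ for every $\tau$ with $1\le\tau\le m$; \item $\sum_{i=1}^{\tau}c_i\le\sum_{j=1}^{m}\min\{b_j,\tau\}+\sum_{j=1}^{l}\min\{h_j,\tau\}$ for every $\tau$ with $1\le\tau\le n$; \item $\sum_{i=1}^{\tau}g_i\le\sum_{j=1}^{m}\min\{b_j,\tau\}+\sum_{j=1}^{n}\min\{d_j,\tau\}$ for every $\tau$ with $1\le\tau\le l$. \end{itemize}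
   Context: A tripartite graph is a simple graph whose vertex set is partitioned into three classes $X,Y,Z$ with no edge joining two vertices of the same class. $d_G(v)$ denotes the degree of $v$ in $G$. -}

module Defs where

open import Data.Nat using (ℕ; zero; suc; _+_; _⊓_; _≤_)
open import Data.Bool using (Bool; true; false)
open import Data.Fin using (Fin; zero; suc; toℕ; _<_)

sumFin : (k : ℕ) → (Fin k → ℕ) → ℕ
sumFin zero    f = 0
sumFin (suc k) f = f zero + sumFin k (λ i → f (suc i))

count : (k : ℕ) → (Fin k → Bool) → ℕ
count k p = sumFin k (λ i → bit (p i))
  where
  bit : Bool → ℕ
  bit true  = 1
  bit false = 0

-- sum of the first τ terms f 0 + … + f (τ-1)  (1-based: a_1 + … + a_τ)
sumFirst : (k : ℕ) → (Fin k → ℕ) → ℕ → ℕ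
sumFirst k f τ = sumFin k (λ i → restrict (toℕ i) (f i))
  where
  open import Relation.Nullary using (yes; no)
  open import Data.Nat using (_<?_)
  restrict : ℕ → ℕ → ℕ
  restrict j x with j <? τ
  ... | yes _ = x
  ... | no  _ = 0

-- A simple tripartite graph with classes X = Fin m, Y = Fin n, Z = Fin l.
-- Edges occur only between distinct classes; each pair is an edge or not
-- (no loops, no multiple edges).
record Tripartite (m n l : ℕ) : Set where
  field
    XY : Fin m → Fin n → Bool
    XZ : Fin m → Fin l → Bool
    YZ : Fin n → Fin l → Bool

module _ {m n l : ℕ} (G : Tripartite m n l) where
  open Tripartite G
  degX : Fin m → ℕ
  degX i = count n (XY i) + count l (XZ i)
  degY : Fin n → ℕ
  degY j = count m (λ i → XY i j) + count l (YZ j)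
  degZ : Fin l → ℕ
  degZ k = count m (λ i → XZ i k) + count n (λ j → YZ j k)

NonIncr : (k : ℕ) → (Fin k → ℕ) → Set
NonIncr k f = ∀ (i j : Fin k) → toℕ i ≤ toℕ j → f j ≤ f i

{-# OPTIONS --safe #-}
-- Count the edges leaving the first τ vertices x₁, …, x_τ.  Their number is at
-- least a₁ + ⋯ + a_τ, and it is the sum, over the vertices y of the other two
-- classes, of the number of neighbours of y among x₁, …, x_τ; that number is at
-- most τ and at most d_G(y), hence at most min(d_j, τ) or min(h_j, τ).
module Submission where

open import Defs
open import Data.Nat using (ℕ; zero; suc; z≤n; s≤s; _≤_; _⊓_; _+_; _<?_; NonZero)
open import Data.Nat.Properties
open import Data.Fin using (Fin; zero; suc; toℕ)
open import Data.Bool using (Bool; true; false)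
open import Data.Product using (_×_; _,_; proj₁)
open import Function using (_∘_)
open import Relation.Nullary using (yes; no; contradiction)
open import Relation.Binary.PropositionalEquality
open import Algebra.Properties.CommutativeMonoid.Sum +-0-commutativeMonoid
  using (sum; sum-cong-≗; sum-replicate-zero; ∑-distrib-+; ∑-comm)

sumFin≡sum : ∀ k (f : Fin k → ℕ) → sumFin k f ≡ sum f
sumFin≡sum zero    f = refl
sumFin≡sum (suc k) f = cong (f zero +_) (sumFin≡sum k (f ∘ suc))

sumFin-cong : ∀ k {f g : Fin k → ℕ} → (∀ i → f i ≡ g i) → sumFin k f ≡ sumFin k g
sumFin-cong k {f} {g} f≗g = begin
  sumFin k f ≡⟨ sumFin≡sum k f ⟩
  sum f      ≡⟨ sum-cong-≗ f≗g ⟩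
  sum g      ≡⟨ sumFin≡sum k g ⟨
  sumFin k g ∎
  where open ≡-Reasoning

sumFin-mono-≤ : ∀ k {f g : Fin k → ℕ} → (∀ i → f i ≤ g i) → sumFin k f ≤ sumFin k g
sumFin-mono-≤ zero    f≤g = z≤n
sumFin-mono-≤ (suc k) f≤g = +-mono-≤ (f≤g zero) (sumFin-mono-≤ k (f≤g ∘ suc))

sumFin-distrib-+ : ∀ k (f g : Fin k → ℕ) →
  sumFin k (λ i → f i + g i) ≡ sumFin k f + sumFin k g
sumFin-distrib-+ k f g = begin
  sumFin k (λ i → f i + g i) ≡⟨ sumFin≡sum k _ ⟩
  sum (λ i → f i + g i)      ≡⟨ ∑-distrib-+ f g ⟩
  sum f + sum g              ≡⟨ cong₂ _+_ (sumFin≡sum k f) (sumFin≡sum k g) ⟨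
  sumFin k f + sumFin k g    ∎
  where open ≡-Reasoning

sumFin-comm : ∀ m n (F : Fin m → Fin n → ℕ) →
  sumFin m (λ i → sumFin n (F i)) ≡ sumFin n (λ j → sumFin m (λ i → F i j))
sumFin-comm m n F = begin
  sumFin m (λ i → sumFin n (F i))       ≡⟨ sumFin-cong m (λ i → sumFin≡sum n (F i)) ⟩
  sumFin m (λ i → sum (F i))            ≡⟨ sumFin≡sum m _ ⟩
  sum (λ i → sum (F i))                 ≡⟨ ∑-comm F ⟩
  sum (λ j → sum (λ i → F i j))         ≡⟨ sumFin≡sum n _ ⟨
  sumFin n (λ j → sum (λ i → F i j))    ≡⟨ sumFin-cong n (λ j → sumFin≡sum m _) ⟨
  sumFin n (λ j → sumFin m (λ i → F i j)) ∎
  where open ≡-Reasoning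

keepBelow : ℕ → ℕ → ℕ → ℕ
keepBelow τ j x with j <? τ
... | yes _ = x
... | no  _ = 0

keepBelow-≤ : ∀ τ j x → keepBelow τ j x ≤ x
keepBelow-≤ τ j x with j <? τ
... | yes _ = ≤-refl
... | no  _ = z≤n

keepBelow-mono-≤ : ∀ τ j {x y} → x ≤ y → keepBelow τ j x ≤ keepBelow τ j y
keepBelow-mono-≤ τ j x≤y with j <? τ
... | yes _ = x≤y
... | no  _ = z≤n

keepBelow-distrib-+ : ∀ τ j x y → keepBelow τ j (x + y) ≡ keepBelow τ j x + keepBelow τ j y
keepBelow-distrib-+ τ j x y with j <? τ
... | yes _ = refl
... | no  _ = refl

keepBelow-sumFin : ∀ τ j k (f : Fin k → ℕ) →
  keepBelow τ j (sumFin k f) ≡ sumFin k (keepBelow τ j ∘ f)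
keepBelow-sumFin τ j zero    f with j <? τ
... | yes _ = refl
... | no  _ = refl
keepBelow-sumFin τ j (suc k) f = trans (keepBelow-distrib-+ τ j (f zero) _)
  (cong (keepBelow τ j (f zero) +_) (keepBelow-sumFin τ j k (f ∘ suc)))

keepBelow-zero : ∀ j x → keepBelow 0 j x ≡ 0
keepBelow-zero j x with j <? 0
... | no _ = refl

keepBelow-suc : ∀ τ j x → keepBelow (suc τ) (suc j) x ≡ keepBelow τ j x
keepBelow-suc τ j x with suc j <? suc τ | j <? τ
... | yes _       | yes _ = refl
... | no  _       | no  _ = refl
... | yes (s≤s p) | no ¬p = contradiction p ¬p
... | no ¬p       | yes p = contradiction (s≤s p) ¬p

-- The left-hand side `_` is the summand of Defs.sumFirst, whose local helper cannot be named.
mutual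
  sumFirst≡sumFin-keepBelow : ∀ k (f : Fin k → ℕ) τ →
    sumFirst k f τ ≡ sumFin k (λ i → keepBelow τ (toℕ i) (f i))
  sumFirst≡sumFin-keepBelow k f τ = sumFin-cong k (restrict≡keepBelow k f τ)

  restrict≡keepBelow : ∀ k (f : Fin k → ℕ) τ i → _ ≡ keepBelow τ (toℕ i) (f i)
  restrict≡keepBelow k f τ i with toℕ i <? τ
  ... | yes _ = refl
  ... | no  _ = refl

sumFirst-mono-≤ : ∀ k {f g : Fin k → ℕ} τ → (∀ i → f i ≤ g i) → sumFirst k f τ ≤ sumFirst k g τ
sumFirst-mono-≤ k {f} {g} τ f≤g = begin
  sumFirst k f τ                               ≡⟨ sumFirst≡sumFin-keepBelow k f τ ⟩
  sumFin k (λ i → keepBelow τ (toℕ i) (f i))  ≤⟨ sumFin-mono-≤ k (λ i → keepBelow-mono-≤ τ (toℕ i) (f≤g i)) ⟩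
  sumFin k (λ i → keepBelow τ (toℕ i) (g i))  ≡⟨ sumFirst≡sumFin-keepBelow k g τ ⟨
  sumFirst k g τ                               ∎
  where open ≤-Reasoning

sumFirst-cong : ∀ k {f g : Fin k → ℕ} τ → (∀ i → f i ≡ g i) → sumFirst k f τ ≡ sumFirst k g τ
sumFirst-cong k τ f≗g = ≤-antisym (sumFirst-mono-≤ k τ (≤-reflexive ∘ f≗g))
                                  (sumFirst-mono-≤ k τ (≤-reflexive ∘ sym ∘ f≗g))

sumFirst≤sumFin : ∀ k (f : Fin k → ℕ) τ → sumFirst k f τ ≤ sumFin k f
sumFirst≤sumFin k f τ = ≤-trans (≤-reflexive (sumFirst≡sumFin-keepBelow k f τ))
  (sumFin-mono-≤ k (λ i → keepBelow-≤ τ (toℕ i) (f i)))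

sumFirst-distrib-+ : ∀ k (f g : Fin k → ℕ) τ →
  sumFirst k (λ i → f i + g i) τ ≡ sumFirst k f τ + sumFirst k g τ
sumFirst-distrib-+ k f g τ = begin
  sumFirst k (λ i → f i + g i) τ
    ≡⟨ sumFirst≡sumFin-keepBelow k _ τ ⟩
  sumFin k (λ i → keepBelow τ (toℕ i) (f i + g i))
    ≡⟨ sumFin-cong k (λ i → keepBelow-distrib-+ τ (toℕ i) (f i) (g i)) ⟩
  sumFin k (λ i → keepBelow τ (toℕ i) (f i) + keepBelow τ (toℕ i) (g i))
    ≡⟨ sumFin-distrib-+ k _ _ ⟩
  sumFin k (λ i → keepBelow τ (toℕ i) (f i)) + sumFin k (λ i → keepBelow τ (toℕ i) (g i))
    ≡⟨ cong₂ _+_ (sumFirst≡sumFin-keepBelow k f τ) (sumFirst≡sumFin-keepBelow k g τ) ⟨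
  sumFirst k f τ + sumFirst k g τ ∎
  where open ≡-Reasoning

sumFirst-sumFin-comm : ∀ m n (F : Fin m → Fin n → ℕ) τ →
  sumFirst m (λ i → sumFin n (F i)) τ ≡ sumFin n (λ j → sumFirst m (λ i → F i j) τ)
sumFirst-sumFin-comm m n F τ = begin
  sumFirst m (λ i → sumFin n (F i)) τ
    ≡⟨ sumFirst≡sumFin-keepBelow m _ τ ⟩
  sumFin m (λ i → keepBelow τ (toℕ i) (sumFin n (F i)))
    ≡⟨ sumFin-cong m (λ i → keepBelow-sumFin τ (toℕ i) n (F i)) ⟩
  sumFin m (λ i → sumFin n (λ j → keepBelow τ (toℕ i) (F i j)))
    ≡⟨ sumFin-comm m n _ ⟩
  sumFin n (λ j → sumFin m (λ i → keepBelow τ (toℕ i) (F i j)))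
    ≡⟨ sumFin-cong n (λ j → sumFirst≡sumFin-keepBelow m (λ i → F i j) τ) ⟨
  sumFin n (λ j → sumFirst m (λ i → F i j) τ) ∎
  where open ≡-Reasoning

sumFirst-≤1⇒≤ : ∀ k (f : Fin k → ℕ) τ → (∀ i → f i ≤ 1) → sumFirst k f τ ≤ τ
sumFirst-≤1⇒≤ k f τ f≤1 = ≤-trans (≤-reflexive (sumFirst≡sumFin-keepBelow k f τ)) (go k f τ f≤1)
  where
  go : ∀ k (f : Fin k → ℕ) τ → (∀ i → f i ≤ 1) → sumFin k (λ i → keepBelow τ (toℕ i) (f i)) ≤ τ
  go zero    f τ       f≤1 = z≤n
  go (suc k) f zero    f≤1 = ≤-reflexive (begin
    sumFin (suc k) (λ i → keepBelow 0 (toℕ i) (f i)) ≡⟨ sumFin-cong (suc k) (λ i → keepBelow-zero (toℕ i) (f i)) ⟩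
    sumFin (suc k) (λ _ → 0)                          ≡⟨ sumFin≡sum (suc k) (λ _ → 0) ⟩
    sum {suc k} (λ _ → 0)                             ≡⟨ sum-replicate-zero (suc k) ⟩
    0 ∎)
    where open ≡-Reasoning
  go (suc k) f (suc τ) f≤1 = +-mono-≤ (≤-trans (keepBelow-≤ (suc τ) 0 (f zero)) (f≤1 zero))
    (≤-trans (≤-reflexive (sumFin-cong k (λ i → keepBelow-suc τ (toℕ i) (f (suc i)))))
             (go k (f ∘ suc) τ (f≤1 ∘ suc)))

indicator : Bool → ℕ
indicator true  = 1
indicator false = 0

indicator≤1 : ∀ b → indicator b ≤ 1
indicator≤1 true  = ≤-refl
indicator≤1 false = z≤n

mutual
  count≡sumFin-indicator : ∀ k (p : Fin k → Bool) → count k p ≡ sumFin k (indicator ∘ p)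
  count≡sumFin-indicator k p = sumFin-cong k (bit≡indicator k p)

  bit≡indicator : ∀ k (p : Fin k → Bool) i → _ ≡ indicator (p i)
  bit≡indicator k p i with p i
  ... | true  = refl
  ... | false = refl

sumFirst-count-≤ : ∀ m n (E : Fin m → Fin n → Bool) τ →
  sumFirst m (λ i → count n (E i)) τ ≤ sumFin n (λ j → count m (λ i → E i j) ⊓ τ)
sumFirst-count-≤ m n E τ = begin
  sumFirst m (λ i → count n (E i)) τ
    ≡⟨ sumFirst-cong m τ (λ i → count≡sumFin-indicator n (E i)) ⟩
  sumFirst m (λ i → sumFin n (indicator ∘ E i)) τ
    ≡⟨ sumFirst-sumFin-comm m n (λ i j → indicator (E i j)) τ ⟩
  sumFin n (λ j → sumFirst m (λ i → indicator (E i j)) τ)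
    ≤⟨ sumFin-mono-≤ n (λ j → ⊓-glb (column≤count j) (column≤τ j)) ⟩
  sumFin n (λ j → count m (λ i → E i j) ⊓ τ) ∎
  where
  open ≤-Reasoning
  column≤count : ∀ j → sumFirst m (λ i → indicator (E i j)) τ ≤ count m (λ i → E i j)
  column≤count j = ≤-trans (sumFirst≤sumFin m _ τ)
                           (≤-reflexive (sym (count≡sumFin-indicator m (λ i → E i j))))
  column≤τ : ∀ j → sumFirst m (λ i → indicator (E i j)) τ ≤ τ
  column≤τ j = sumFirst-≤1⇒≤ m _ τ (λ i → indicator≤1 (E i j))

sumFirst-degree-≤ : ∀ m n₁ n₂ τ (E₁ : Fin m → Fin n₁ → Bool) (E₂ : Fin m → Fin n₂ → Bool)
  {a : Fin m → ℕ} {d₁ : Fin n₁ → ℕ} {d₂ : Fin n₂ → ℕ} →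
  (∀ i → a i ≤ count n₁ (E₁ i) + count n₂ (E₂ i)) →
  (∀ j → count m (λ i → E₁ i j) ≤ d₁ j) →
  (∀ k → count m (λ i → E₂ i k) ≤ d₂ k) →
  sumFirst m a τ ≤ sumFin n₁ (λ j → d₁ j ⊓ τ) + sumFin n₂ (λ k → d₂ k ⊓ τ)
sumFirst-degree-≤ m n₁ n₂ τ E₁ E₂ {a} {d₁} {d₂} a≤deg deg₁≤d₁ deg₂≤d₂ = begin
  sumFirst m a τ
    ≤⟨ sumFirst-mono-≤ m τ a≤deg ⟩
  sumFirst m (λ i → count n₁ (E₁ i) + count n₂ (E₂ i)) τ
    ≡⟨ sumFirst-distrib-+ m _ _ τ ⟩
  sumFirst m (λ i → count n₁ (E₁ i)) τ + sumFirst m (λ i → count n₂ (E₂ i)) τ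
    ≤⟨ +-mono-≤ (sumFirst-count-≤ m n₁ E₁ τ) (sumFirst-count-≤ m n₂ E₂ τ) ⟩
  sumFin n₁ (λ j → count m (λ i → E₁ i j) ⊓ τ) + sumFin n₂ (λ k → count m (λ i → E₂ i k) ⊓ τ)
    ≤⟨ +-mono-≤ (sumFin-mono-≤ n₁ (λ j → ⊓-monoˡ-≤ τ (deg₁≤d₁ j)))
                (sumFin-mono-≤ n₂ (λ k → ⊓-monoˡ-≤ τ (deg₂≤d₂ k))) ⟩
  sumFin n₁ (λ j → d₁ j ⊓ τ) + sumFin n₂ (λ k → d₂ k ⊓ τ) ∎
  where open ≤-Reasoning

theorem2p2 : (m n l : ℕ) → NonZero m → NonZero n → NonZero l →
    (a b : Fin m → ℕ) (c d : Fin n → ℕ) (g h : Fin l → ℕ) →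
    NonIncr m a → NonIncr n c → NonIncr l g →
    (G : Tripartite m n l) →
    (∀ i → (a i ≤ degX G i) × (degX G i ≤ b i)) →
    (∀ j → (c j ≤ degY G j) × (degY G j ≤ d j)) →
    (∀ k → (g k ≤ degZ G k) × (degZ G k ≤ h k)) →
    (∀ τ → 1 ≤ τ → τ ≤ m →
      sumFirst m a τ ≤ sumFin n (λ j → d j ⊓ τ) + sumFin l (λ j → h j ⊓ τ))
    × (∀ τ → 1 ≤ τ → τ ≤ n →
      sumFirst n c τ ≤ sumFin m (λ j → b j ⊓ τ) + sumFin l (λ j → h j ⊓ τ))
    × (∀ τ → 1 ≤ τ → τ ≤ l →
      sumFirst l g τ ≤ sumFin m (λ j → b j ⊓ τ) + sumFin n (λ j → d j ⊓ τ))
theorem2p2 m n l _ _ _ a b c d g h _ _ _ G degX∈ degY∈ degZ∈ =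
    (λ τ _ _ → sumFirst-degree-≤ m n l τ XY XZ
                 (proj₁ ∘ degX∈) (firstPart ∘ degY∈) (firstPart ∘ degZ∈))
  , (λ τ _ _ → sumFirst-degree-≤ n m l τ (λ j i → XY i j) YZ
                 (proj₁ ∘ degY∈) (firstPart ∘ degX∈) (secondPart ∘ degZ∈))
  , (λ τ _ _ → sumFirst-degree-≤ l m n τ (λ k i → XZ i k) (λ k j → YZ j k)
                 (proj₁ ∘ degZ∈) (secondPart ∘ degX∈) (secondPart ∘ degY∈))
  where
  open Tripartite G
  firstPart : ∀ {x y u v} → (u ≤ x + y) × (x + y ≤ v) → x ≤ v
  firstPart (_ , x+y≤v) = ≤-trans (m≤m+n _ _) x+y≤v
  secondPart : ∀ {x y u v} → (u ≤ x + y) × (x + y ≤ v) → y ≤ v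
  secondPart (_ , x+y≤v) = ≤-trans (m≤n+m _ _) x+y≤v
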